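{- Let $s\ge2$, $2\le i\le s$, and let $\mu=(\mu_1,\dots,\mu_s)\vdash n$ with $\mu_{i-1}>\mu_i$. Then $$f(\mu^{\uparrow i})-f(\mu)\ge f(\mu^{\uparrow i}-\hat{1})>0.$$
   Context: Partitions are non-increasing sequences of positive integers; $\lambda\vdash n$ means the parts sum to $n$. For $\lambda=(\lambda_1,\dots,\lambda_r)$: $\lambda\setminus\lambda_r:=(\lambda_1,\dots,\lambda_{r-1})$; for $1\le k\le\lambda_r$, $\lambda-\hat{k}:=(\lambda_1-k,\dots,\lambda_r-k)$; zero parts are deleted and the all-zero sequence is identified with $(0)$. For $\mu$ of length $s$ with $\mu_{i-1}>\mu_i$, $\mu^{\uparrow i}$ replaces $\mu_i$ by $\mu_i+1$. Define $d_0=1$, $d_1=0$, $d_n=2(n-1)(d_{n-1}+d_{n-2})$ for $n\ge2$. Define $f$ on partitions recursively: $f((0))=1$; $f((n))=d_n$ for $n\ge1$; and for $\lambda=(\lambda_1,\dots,\lambda_r)$ with $r\ge2$, $f(\lambda)=f(\lambda\setminus\lambda_r)+\sum_{k=1}^{\lambda_r}\binom{\lambda_r}{k}(2k-1)!!\,f(\lambda\setminus\lambda_r-\hat{k})$. -}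

module Defs where

open import Data.Nat using (ℕ; zero; suc; _+_; _*_; _∸_; _<_; _≤_)
open import Data.Nat.Combinatorics using (_C_)
open import Data.List using (List; []; _∷_; map; reverse; length)
open import Data.Nat.ListAction using (sum)
open import Data.List.Relation.Unary.All using (All)
open import Data.List.Relation.Unary.Linked using (Linked)
open import Data.Product using (_×_)
open import Relation.Binary.PropositionalEquality using (_≡_)

-- A partition λ = (λ₁,…,λᵣ) is a list of positive integers in
-- non-increasing order λ₁ ≥ λ₂ ≥ … ≥ λᵣ > 0.
-- The partition (0) (all-zero sequence) is represented by [].
IsPartition : List ℕ → Set
IsPartition l = All (0 <_) l × Linked (λ a b → b ≤ a) l

_⊢_ : List ℕ → ℕ → Set
l ⊢ n = IsPartition l × (sum l ≡ n)

-- 1-indexed entry μᵢ (0 if out of range; only used in range)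
entry : List ℕ → ℕ → ℕ
entry []       _             = 0
entry (x ∷ xs) zero          = 0
entry (x ∷ xs) (suc zero)    = x
entry (x ∷ xs) (suc (suc i)) = entry xs (suc i)

-- μ^{↑i}: replace μᵢ by μᵢ + 1 (1-indexed)
bump : List ℕ → ℕ → List ℕ
bump []       _             = []
bump (x ∷ xs) zero          = x ∷ xs
bump (x ∷ xs) (suc zero)    = suc x ∷ xs
bump (x ∷ xs) (suc (suc i)) = x ∷ bump xs (suc i)

dropZeros : List ℕ → List ℕ
dropZeros []            = []
dropZeros (zero ∷ xs)   = dropZeros xs
dropZeros (suc x ∷ xs)  = suc x ∷ dropZeros xs

-- λ - k̂ : subtract k from every part, delete zero parts
-- (the empty result stands for the partition (0))
minusHat : List ℕ → ℕ → List ℕ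
minusHat l k = dropZeros (map (_∸ k) l)

d : ℕ → ℕ
d zero          = 1
d (suc zero)    = 0
d (suc (suc n)) = 2 * suc n * (d (suc n) + d n)

-- (2k-1)!!, with (-1)!! = 1
oddDF : ℕ → ℕ
oddDF zero    = 1
oddDF (suc k) = suc (2 * k) * oddDF k

sumFrom1 : ℕ → (ℕ → ℕ) → ℕ
sumFrom1 zero    h = 0
sumFrom1 (suc m) h = sumFrom1 m h + h (suc m)

-- f computed on the REVERSED partition (λᵣ ∷ λᵣ₋₁ ∷ … ∷ λ₁), with fuel.
-- Since subtracting k from all parts of a non-increasing list gives a
-- non-increasing list, minusHat commutes with reversal.
fRev : ℕ → List ℕ → ℕ
fRev _          []            = 1
fRev zero       (_ ∷ _)       = 0   -- unreachable with sufficient fuel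
fRev (suc fuel) (n ∷ [])      = d n
fRev (suc fuel) (x ∷ y ∷ rest) =
  fRev fuel (y ∷ rest)
  + sumFrom1 x (λ k → (x C k) * oddDF k * fRev fuel (minusHat (y ∷ rest) k))

-- f(λ) for λ = (λ₁,…,λᵣ) written in non-increasing order;
-- f([]) = f((0)) = 1, f((n)) = dₙ, and for r ≥ 2
-- f(λ) = f(λ∖λᵣ) + Σ_{k=1}^{λᵣ} C(λᵣ,k) (2k-1)!! f(λ∖λᵣ - k̂).
f : List ℕ → ℕ
f l = fRev (length l) (reverse l)

-- Reversed into an increasing list and with zero parts allowed (so that λ - k̂ is a plain
-- map), the recursion for f expands over the smallest part x with weights C(x,k)(2k-1)!!.
-- Raising a part y that is followed by a larger part is handled by induction on the number
-- of parts below y.  If y is the smallest part, Pascal's rule C(y+1,k+1) = C(y,k+1) + C(y,k)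
-- and (2k-1)!! ≤ (2k+1)!! split the expansion of μ↑ into that of μ plus a term dominating
-- that of μ↑ - 1̂.  Otherwise all three are expanded over the smallest part x ≤ y: each
-- summand is the induction hypothesis for the list minus k̂, and the weights for x - 1 are
-- at most those for x.  For positivity, a nonempty list c and c - 1̂ never both have value
-- 0, and a part ≥ 1 placed below c contributes at least the sum of the two.
module Submission where

open import Defs
open import Data.Nat using (ℕ; zero; suc; _+_; _*_; _∸_; _≤_; _<_; _≥_; _≤′_; ≤′-reflexive; ≤′-step; z≤n; s≤s; z<s; pred)
open import Data.Nat.Properties
open import Data.Nat.Combinatorics using (_C_; nCk+nC[k+1]≡[n+1]C[k+1]; nC1≡n)
open import Data.List using (List; []; _∷_; _++_; map; length; reverse; _ʳ++_)
open import Data.List.Properties using (length-map; length-reverse; map-++; map-∘; map-cong; map-id; reverse-map; ++-ʳ++; ʳ++-defn)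
open import Data.List.Relation.Unary.All using (All; []; _∷_)
import Data.List.Relation.Unary.All as All
open import Data.List.Relation.Unary.All.Properties using (++⁺; ++⁻ˡ; ++⁻ʳ; map⁺)
open import Data.List.Relation.Unary.Linked using (Linked; []; [-]; _∷_)
import Data.List.Relation.Unary.Linked as Linked
open import Data.List.Relation.Unary.Linked.Properties using (Linked⇒All)
import Data.List.Relation.Unary.Linked.Properties as Linked
open import Data.Integer using (+_; _-_) renaming (_≤_ to _≤ℤ_; _<_ to _<ℤ_)
open import Data.Integer.Properties using ([+m]-[+n]≡m⊖n; ≤-⊖)
import Data.Integer as ℤ
open import Data.Product using (_×_; _,_; ∃-syntax)
open import Function using (_∘_; flip)
open import Algebra.Properties.CommutativeSemigroup +-commutativeSemigroup using (interchange)
open import Relation.Binary.PropositionalEquality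

sum≤ : ℕ → (ℕ → ℕ) → ℕ
sum≤ zero    g = g 0
sum≤ (suc m) g = sum≤ m g + g (suc m)

sum≤-cong : ∀ m {g h : ℕ → ℕ} → g ≗ h → sum≤ m g ≡ sum≤ m h
sum≤-cong zero    g≗h = g≗h 0
sum≤-cong (suc m) g≗h = cong₂ _+_ (sum≤-cong m g≗h) (g≗h (suc m))

sum≤-mono : ∀ m {g h : ℕ → ℕ} → (∀ {k} → k ≤ m → g k ≤ h k) → sum≤ m g ≤ sum≤ m h
sum≤-mono zero    g≤h = g≤h z≤n
sum≤-mono (suc m) g≤h = +-mono-≤ (sum≤-mono m (g≤h ∘ m≤n⇒m≤1+n)) (g≤h ≤-refl)

sum≤-monoˡ : ∀ {m n} (g : ℕ → ℕ) → m ≤ n → sum≤ m g ≤ sum≤ n g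
sum≤-monoˡ g = go ∘ ≤⇒≤′
  where
  go : ∀ {m n} → m ≤′ n → sum≤ m g ≤ sum≤ n g
  go (≤′-reflexive refl) = ≤-refl
  go (≤′-step m≤′n)      = ≤-trans (go m≤′n) (m≤m+n _ _)

sum≤-distrib-+ : ∀ m (g h : ℕ → ℕ) → sum≤ m (λ k → g k + h k) ≡ sum≤ m g + sum≤ m h
sum≤-distrib-+ zero    g h = refl
sum≤-distrib-+ (suc m) g h =
  trans (cong (_+ (g (suc m) + h (suc m))) (sum≤-distrib-+ m g h))
        (interchange (sum≤ m g) (sum≤ m h) (g (suc m)) (h (suc m)))

sum≤-suc : ∀ m (g : ℕ → ℕ) → sum≤ (suc m) g ≡ g 0 + sum≤ m (g ∘ suc)
sum≤-suc zero    g = refl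
sum≤-suc (suc m) g = trans (cong (_+ g (suc (suc m))) (sum≤-suc m g)) (+-assoc (g 0) _ _)

sum≤≡+sumFrom1 : ∀ m (g : ℕ → ℕ) → sum≤ m g ≡ g 0 + sumFrom1 m g
sum≤≡+sumFrom1 zero    g = sym (+-identityʳ (g 0))
sum≤≡+sumFrom1 (suc m) g = trans (cong (_+ g (suc m)) (sum≤≡+sumFrom1 m g)) (+-assoc (g 0) _ _)

sumFrom1-cong : ∀ m {g h : ℕ → ℕ} → g ≗ h → sumFrom1 m g ≡ sumFrom1 m h
sumFrom1-cong zero    g≗h = refl
sumFrom1-cong (suc m) g≗h = cong₂ _+_ (sumFrom1-cong m g≗h) (g≗h (suc m))

-- _C_ binds more weakly than _*_, hence the parentheses here and below.
weight : ℕ → ℕ → ℕ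
weight x k = (x C k) * oddDF k

nCk≤[1+n]Ck : ∀ n k → n C k ≤ suc n C k
nCk≤[1+n]Ck n zero    = ≤-refl
nCk≤[1+n]Ck n (suc k) = subst (n C suc k ≤_) (nCk+nC[k+1]≡[n+1]C[k+1] n k) (m≤n+m _ _)

C-monoˡ : ∀ {m n} k → m ≤ n → m C k ≤ n C k
C-monoˡ k = go ∘ ≤⇒≤′
  where
  go : ∀ {m n} → m ≤′ n → m C k ≤ n C k
  go (≤′-reflexive refl) = ≤-refl
  go (≤′-step m≤′n)      = ≤-trans (go m≤′n) (nCk≤[1+n]Ck _ k)

weight-monoˡ : ∀ {m n} k → m ≤ n → weight m k ≤ weight n k
weight-monoˡ k m≤n = *-monoˡ-≤ (oddDF k) (C-monoˡ k m≤n)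

oddDF-≤-suc : ∀ k → oddDF k ≤ oddDF (suc k)
oddDF-≤-suc k = m≤n*m (oddDF k) (suc (2 * k))

weight-pascal : ∀ y k t →
  weight y (suc k) * t + (y C k) * oddDF (suc k) * t ≡ weight (suc y) (suc k) * t
weight-pascal y k t = begin
  (y C suc k) * o * t + (y C k) * o * t ≡⟨ *-distribʳ-+ t ((y C suc k) * o) _ ⟨
  ((y C suc k) * o + (y C k) * o) * t ≡⟨ cong (_* t) (*-distribʳ-+ o (y C suc k) _) ⟨
  (y C suc k + y C k) * o * t       ≡⟨ cong (λ c → c * o * t) (+-comm (y C suc k) _) ⟩
  (y C k + y C suc k) * o * t       ≡⟨ cong (λ c → c * o * t) (nCk+nC[k+1]≡[n+1]C[k+1] y k) ⟩
  (suc y C suc k) * o * t           ∎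
  where
  open ≡-Reasoning
  o = oddDF (suc k)

weight-pascal-sum : ∀ y (T : ℕ → ℕ) →
  sum≤ (suc y) (λ k → weight y k * T k) + sum≤ y (λ k → (y C k) * oddDF (suc k) * T (suc k))
    ≡ sum≤ (suc y) (λ k → weight (suc y) k * T k)
weight-pascal-sum y T = begin
  sum≤ (suc y) g + sum≤ y h               ≡⟨ cong (_+ sum≤ y h) (sum≤-suc y g) ⟩
  (g 0 + sum≤ y (g ∘ suc)) + sum≤ y h     ≡⟨ +-assoc (g 0) _ _ ⟩
  g 0 + (sum≤ y (g ∘ suc) + sum≤ y h)     ≡⟨ cong (_+_ (g 0)) (sum≤-distrib-+ y (g ∘ suc) h) ⟨
  g 0 + sum≤ y (λ k → g (suc k) + h k)
    ≡⟨ cong (_+_ (g 0)) (sum≤-cong y (λ k → weight-pascal y k (T (suc k)))) ⟩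
  g 0 + sum≤ y (g⁺ ∘ suc)                 ≡⟨ sum≤-suc y g⁺ ⟨
  sum≤ (suc y) g⁺                         ∎
  where
  open ≡-Reasoning
  g g⁺ h : ℕ → ℕ
  g  k = weight y k * T k
  g⁺ k = weight (suc y) k * T k
  h  k = (y C k) * oddDF (suc k) * T (suc k)

-- F a is f (reverse a) with zero parts deleted, for increasing a (f-dropZeros).  The fuel
-- is the length, which subtracting k̂ preserves, so the zero-fuel clause is never reached.

Fᶠ : ℕ → List ℕ → ℕ
Fᶠ _       []                = 1
Fᶠ _       (x ∷ [])          = d x
Fᶠ zero    (_ ∷ _ ∷ _)       = 0
Fᶠ (suc n) (x ∷ b@(_ ∷ _))   = sum≤ x (λ k → weight x k * Fᶠ n (map (_∸ k) b))

F : List ℕ → ℕ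
F a = Fᶠ (length a) a

F-cons : ∀ x b → 0 < length b → F (x ∷ b) ≡ sum≤ x (λ k → weight x k * F (map (_∸ k) b))
F-cons x b@(_ ∷ _) _ =
  sum≤-cong x (λ k → cong (λ n → weight x k * Fᶠ n (map (_∸ k) b)) (sym (length-map (_∸ k) b)))

0<length-++-∷ : ∀ xs {y : ℕ} {r} → 0 < length (xs ++ y ∷ r)
0<length-++-∷ []      = z<s
0<length-++-∷ (_ ∷ _) = z<s

F-cons-mono : ∀ x b → 0 < length b → F b ≤ F (x ∷ b)
F-cons-mono x b 0<|b| = begin
  F b                               ≡⟨ cong F (map-id b) ⟨
  F (map (_∸ 0) b)                  ≡⟨ *-identityˡ _ ⟨
  weight x 0 * F (map (_∸ 0) b)     ≤⟨ sum≤-monoˡ (λ k → weight x k * F (map (_∸ k) b)) (z≤n {x}) ⟩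
  sum≤ x (λ k → weight x k * F (map (_∸ k) b)) ≡⟨ F-cons x b 0<|b| ⟨
  F (x ∷ b)                         ∎
  where open ≤-Reasoning

F-zero-cons : ∀ b → F (0 ∷ b) ≡ F b
F-zero-cons []          = refl
F-zero-cons b@(_ ∷ _) = trans (F-cons 0 b z<s) (trans (*-identityˡ _) (cong F (map-id b)))

F-++-mono : ∀ P {w r} → F (w ∷ r) ≤ F (P ++ w ∷ r)
F-++-mono []      = ≤-refl
F-++-mono (x ∷ P) {w} {r} = ≤-trans (F-++-mono P) (F-cons-mono x (P ++ w ∷ r) (0<length-++-∷ P))

map-∸-∸ : ∀ j k l → map (_∸ k) (map (_∸ j) l) ≡ map (_∸ (j + k)) l
map-∸-∸ j k l = trans (sym (map-∘ l)) (map-cong (λ x → ∸-+-assoc x j k) l)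

map-∸-comm : ∀ j k l → map (_∸ k) (map (_∸ j) l) ≡ map (_∸ j) (map (_∸ k) l)
map-∸-comm j k l =
  trans (map-∸-∸ j k l) (trans (cong (λ m → map (_∸ m) l) (+-comm j k)) (sym (map-∸-∸ k j l)))

map-∸-++-suc : ∀ xs {k y} b → k ≤ y →
  map (_∸ k) (xs ++ suc y ∷ b) ≡ map (_∸ k) xs ++ suc (y ∸ k) ∷ map (_∸ k) b
map-∸-++-suc xs {k} {y} b k≤y =
  trans (map-++ (_∸ k) xs (suc y ∷ b)) (cong (λ t → map (_∸ k) xs ++ t ∷ map (_∸ k) b) (+-∸-assoc 1 k≤y))

F-bump-head : ∀ y z zs → F (y ∷ z ∷ zs) + F (map (_∸ 1) (suc y ∷ z ∷ zs)) ≤ F (suc y ∷ z ∷ zs)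
F-bump-head y z zs = begin
  F (y ∷ b) + F (y ∷ map (_∸ 1) b)
    ≡⟨ cong₂ _+_ (F-cons y b z<s)
         (trans (F-cons y (map (_∸ 1) b) z<s)
           (sum≤-cong y (λ k → cong (λ l → weight y k * F l) (map-∸-∸ 1 k b)))) ⟩
  sum≤ y (λ k → weight y k * T k) + sum≤ y (λ k → weight y k * T (suc k))
    ≤⟨ +-mono-≤ (sum≤-monoˡ (λ k → weight y k * T k) (n≤1+n y))
         (sum≤-mono y (λ {k} _ → *-monoˡ-≤ (T (suc k)) (*-monoʳ-≤ (y C k) (oddDF-≤-suc k)))) ⟩
  sum≤ (suc y) (λ k → weight y k * T k) + sum≤ y (λ k → (y C k) * oddDF (suc k) * T (suc k))
    ≡⟨ weight-pascal-sum y T ⟩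
  sum≤ (suc y) (λ k → weight (suc y) k * T k)
    ≡⟨ F-cons (suc y) b z<s ⟨
  F (suc y ∷ b) ∎
  where
  open ≤-Reasoning
  b = z ∷ zs
  T : ℕ → ℕ
  T k = F (map (_∸ k) b)

F-bump : ∀ xs y z zs → All (_≤ y) xs →
  F (xs ++ y ∷ z ∷ zs) + F (map (_∸ 1) (xs ++ suc y ∷ z ∷ zs)) ≤ F (xs ++ suc y ∷ z ∷ zs)
F-bump xs y z zs = go (length xs) xs refl
  where
  -- induction on the number of parts below y, which subtracting k does not change
  go : ∀ n xs {y z zs} → length xs ≡ n → All (_≤ y) xs →
    F (xs ++ y ∷ z ∷ zs) + F (map (_∸ 1) (xs ++ suc y ∷ z ∷ zs)) ≤ F (xs ++ suc y ∷ z ∷ zs)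
  go _       []       {y} {z} {zs} _ _ = F-bump-head y z zs
  go (suc n) (x ∷ xs) {y} {z} {zs} |xs|≡ (x≤y ∷ xs≤y) = begin
    F (x ∷ c) + F ((x ∸ 1) ∷ map (_∸ 1) c⁺)
      ≡⟨ cong₂ _+_ (F-cons x c (0<length-++-∷ xs))
           (trans (F-cons (x ∸ 1) (map (_∸ 1) c⁺)
                    (subst (0 <_) (sym (length-map (_∸ 1) c⁺)) (0<length-++-∷ xs)))
             (sum≤-cong (x ∸ 1) (λ k → cong (λ l → weight (x ∸ 1) k * F l) (map-∸-comm 1 k c⁺)))) ⟩
    sum≤ x (λ k → weight x k * A k) + sum≤ (x ∸ 1) (λ k → weight (x ∸ 1) k * B k)
      ≤⟨ +-monoʳ-≤ (sum≤ x (λ k → weight x k * A k))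
           (≤-trans (sum≤-monoˡ (λ k → weight (x ∸ 1) k * B k) (m∸n≤m x 1))
             (sum≤-mono x (λ {k} _ → *-monoˡ-≤ (B k) (weight-monoˡ k (m∸n≤m x 1))))) ⟩
    sum≤ x (λ k → weight x k * A k) + sum≤ x (λ k → weight x k * B k)
      ≡⟨ sum≤-distrib-+ x (λ k → weight x k * A k) (λ k → weight x k * B k) ⟨
    sum≤ x (λ k → weight x k * A k + weight x k * B k)
      ≤⟨ sum≤-mono x (λ {k} k≤x → ≤-trans (≤-reflexive (sym (*-distribˡ-+ (weight x k) (A k) (B k))))
                                     (*-monoʳ-≤ (weight x k) (step k≤x))) ⟩
    sum≤ x (λ k → weight x k * A⁺ k)
      ≡⟨ F-cons x c⁺ (0<length-++-∷ xs) ⟨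
    F (x ∷ c⁺) ∎
    where
    open ≤-Reasoning
    c c⁺ : List ℕ
    c  = xs ++ y ∷ z ∷ zs
    c⁺ = xs ++ suc y ∷ z ∷ zs
    A A⁺ B : ℕ → ℕ
    A  k = F (map (_∸ k) c)
    A⁺ k = F (map (_∸ k) c⁺)
    B  k = F (map (_∸ 1) (map (_∸ k) c⁺))
    step : ∀ {k} → k ≤ x → A k + B k ≤ A⁺ k
    step {k} k≤x =
      subst₂ (λ u v → F u + F (map (_∸ 1) v) ≤ F v)
        (sym (map-++ (_∸ k) xs (y ∷ z ∷ zs))) (sym (map-∸-++-suc xs (z ∷ zs) (≤-trans k≤x x≤y)))
        (go n (map (_∸ k) xs) (trans (length-map (_∸ k) xs) (suc-injective |xs|≡))
          (map⁺ (All.map (∸-monoˡ-≤ k) xs≤y)))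

d-pos : ∀ n → 0 < d (suc (suc n))
d-pos zero    = z<s
d-pos (suc n) = ≤-trans (≤-trans (d-pos n) (m≤m+n _ _)) (m≤m+n _ _)

F+F∸1-pos : ∀ w ws → 0 < F (w ∷ ws) + F (map (_∸ 1) (w ∷ ws))
F+F∸1-pos zero          []        = z<s
F+F∸1-pos (suc zero)    []        = z<s
F+F∸1-pos (suc (suc n)) []        = ≤-trans (d-pos n) (m≤m+n _ _)
F+F∸1-pos w             (w′ ∷ ws) =
  ≤-trans (F+F∸1-pos w′ ws)
    (+-mono-≤ (F-cons-mono w (w′ ∷ ws) z<s) (F-cons-mono (w ∸ 1) (map (_∸ 1) (w′ ∷ ws)) z<s))

F-suc-cons-pos : ∀ y w ws → 0 < F (suc y ∷ w ∷ ws)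
F-suc-cons-pos y w ws = begin-strict
  0                                 <⟨ F+F∸1-pos w ws ⟩
  F c + F (map (_∸ 1) c)            ≡⟨ cong (_+ F (map (_∸ 1) c)) (trans (*-identityˡ _) (cong F (map-id c))) ⟨
  g 0 + F (map (_∸ 1) c)            ≤⟨ +-monoʳ-≤ (g 0) (m≤n*m _ (suc y)) ⟩
  g 0 + suc y * F (map (_∸ 1) c)
    ≡⟨ cong (λ n → g 0 + n * F (map (_∸ 1) c)) (trans (*-identityʳ _) (nC1≡n (suc y))) ⟨
  sum≤ 1 g                          ≤⟨ sum≤-monoˡ g (s≤s (z≤n {y})) ⟩
  sum≤ (suc y) g                    ≡⟨ F-cons (suc y) c z<s ⟨
  F (suc y ∷ c)                     ∎
  where
  open ≤-Reasoning
  c = w ∷ ws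
  g : ℕ → ℕ
  g k = weight (suc y) k * F (map (_∸ k) c)

F-bump-pos : ∀ xs {y} z zs → 0 < y → 0 < F (map (_∸ 1) (xs ++ suc y ∷ z ∷ zs))
F-bump-pos xs {suc y} z zs _ =
  ≤-trans (F-suc-cons-pos y (z ∸ 1) (map (_∸ 1) zs))
    (≤-trans (F-++-mono (map (_∸ 1) xs)) (≤-reflexive (cong F (sym (map-++ (_∸ 1) xs (suc (suc y) ∷ z ∷ zs))))))

dropZeros-pos : ∀ {l} → All (0 <_) l → dropZeros l ≡ l
dropZeros-pos []             = refl
dropZeros-pos (s≤s _ ∷ l>0) = cong (_ ∷_) (dropZeros-pos l>0)

length-dropZeros : ∀ l → length (dropZeros l) ≤ length l
length-dropZeros []          = z≤n
length-dropZeros (zero ∷ l)  = m≤n⇒m≤1+n (length-dropZeros l)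
length-dropZeros (suc _ ∷ l) = s≤s (length-dropZeros l)

ʳ++-dropZeros : ∀ l acc → dropZeros l ʳ++ dropZeros acc ≡ dropZeros (l ʳ++ acc)
ʳ++-dropZeros []          acc = refl
ʳ++-dropZeros (zero ∷ l)  acc = ʳ++-dropZeros l (0 ∷ acc)
ʳ++-dropZeros (suc x ∷ l) acc = ʳ++-dropZeros l (suc x ∷ acc)

reverse-dropZeros : ∀ l → reverse (dropZeros l) ≡ dropZeros (reverse l)
reverse-dropZeros l = ʳ++-dropZeros l []

Linked-ʳ++ : ∀ {a r} {A : Set a} {R : A → A → Set r} {x xs acc} →
  Linked R (x ∷ xs) → Linked (flip R) (x ∷ acc) → Linked (flip R) (xs ʳ++ (x ∷ acc))
Linked-ʳ++ [-]          rev = rev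
Linked-ʳ++ (Rxy ∷ rest) rev = Linked-ʳ++ rest (Rxy ∷ rev)

Linked-reverse : ∀ {a r} {A : Set a} {R : A → A → Set r} {xs} →
  Linked R xs → Linked (flip R) (reverse xs)
Linked-reverse {xs = []}    _  = []
Linked-reverse {xs = _ ∷ _} lk = Linked-ʳ++ lk [-]

Linked-map-∸ : ∀ k {l} → Linked _≤_ l → Linked _≤_ (map (_∸ k) l)
Linked-map-∸ k = Linked.map⁺ ∘ Linked.map (∸-monoˡ-≤ k)

mutual
  fRev-dropZeros : ∀ fuel a → Linked _≤_ a → length (dropZeros a) ≤ fuel →
    fRev fuel (dropZeros a) ≡ F a
  fRev-dropZeros fuel []          _   _  = refl
  fRev-dropZeros fuel (zero ∷ a)  asc le =
    trans (fRev-dropZeros fuel a (Linked.tail asc) le) (sym (F-zero-cons a))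
  fRev-dropZeros fuel (suc x ∷ a) asc le =
    trans (cong (λ l → fRev fuel (suc x ∷ l)) a≡)
          (fRev-pos fuel x a asc (subst (λ l → length (suc x ∷ l) ≤ fuel) a≡ le))
    where
    a≡ : dropZeros a ≡ a
    a≡ = dropZeros-pos (All.tail (Linked⇒All ≤-trans (s≤s z≤n) asc))

  fRev-pos : ∀ fuel x a → Linked _≤_ (suc x ∷ a) → length (suc x ∷ a) ≤ fuel →
    fRev fuel (suc x ∷ a) ≡ F (suc x ∷ a)
  fRev-pos (suc fuel) x []          _               _        = refl
  fRev-pos (suc fuel) x (suc y ∷ r) (s≤s _ ∷ asc) (s≤s le) = begin
    fRev fuel (suc y ∷ r) + sumFrom1 (suc x) (λ k → weight (suc x) k * fRev fuel (minusHat (suc y ∷ r) k))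
      ≡⟨ cong₂ _+_
           (trans (fRev-pos fuel y r asc le) (sym (trans (*-identityˡ _) (cong F (map-id (suc y ∷ r))))))
           (sumFrom1-cong (suc x) (λ k → cong (weight (suc x) k *_)
             (fRev-dropZeros fuel (map (_∸ k) (suc y ∷ r)) (Linked-map-∸ k asc) (bound k)))) ⟩
    g 0 + sumFrom1 (suc x) g ≡⟨ sum≤≡+sumFrom1 (suc x) g ⟨
    sum≤ (suc x) g           ≡⟨ F-cons (suc x) (suc y ∷ r) z<s ⟨
    F (suc x ∷ suc y ∷ r)    ∎
    where
    open ≡-Reasoning
    g : ℕ → ℕ
    g k = weight (suc x) k * F (map (_∸ k) (suc y ∷ r))
    bound : ∀ k → length (minusHat (suc y ∷ r) k) ≤ fuel
    bound k = ≤-trans (length-dropZeros (map (_∸ k) (suc y ∷ r)))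
                      (≤-trans (≤-reflexive (length-map (_∸ k) (suc y ∷ r))) le)

f-dropZeros : ∀ l → Linked _≤_ (reverse l) → f (dropZeros l) ≡ F (reverse l)
f-dropZeros l asc =
  trans (cong (fRev (length (dropZeros l))) (reverse-dropZeros l))
    (fRev-dropZeros _ (reverse l) asc
      (≤-reflexive (trans (cong length (sym (reverse-dropZeros l))) (length-reverse (dropZeros l)))))

f≡F∘reverse : ∀ {l} → All (0 <_) l → Linked _≤_ (reverse l) → f l ≡ F (reverse l)
f≡F∘reverse {l} l>0 asc = trans (cong f (sym (dropZeros-pos l>0))) (f-dropZeros l asc)

f-minusHat : ∀ k l → Linked _≤_ (reverse l) → f (minusHat l k) ≡ F (map (_∸ k) (reverse l))
f-minusHat k l asc =
  trans (f-dropZeros (map (_∸ k) l) (subst (Linked _≤_) (reverse-map (_∸ k) l) (Linked-map-∸ k asc)))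
    (cong F (sym (reverse-map (_∸ k) l)))

Linked-++-bump : ∀ xs {y z zs} → Linked _≤_ (xs ++ y ∷ z ∷ zs) → y < z →
  Linked _≤_ (xs ++ suc y ∷ z ∷ zs)
Linked-++-bump []            (_ ∷ asc)   y<z = y<z ∷ asc
Linked-++-bump (_ ∷ [])      (x≤y ∷ asc) y<z = m≤n⇒m≤1+n x≤y ∷ Linked-++-bump [] asc y<z
Linked-++-bump (_ ∷ _ ∷ xs)  (x≤x′ ∷ asc) y<z = x≤x′ ∷ Linked-++-bump (_ ∷ xs) asc y<z

Linked-++⇒All≤ : ∀ xs {y r} → Linked _≤_ (xs ++ y ∷ r) → All (_≤ y) xs
Linked-++⇒All≤ []       _   = []
Linked-++⇒All≤ (x ∷ xs) asc =
  All.head (++⁻ʳ xs (All.tail (Linked⇒All ≤-trans ≤-refl asc))) ∷ Linked-++⇒All≤ xs (Linked.tail asc)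

reverse-++-∷-∷ : ∀ p {u v : ℕ} q → reverse (p ++ u ∷ v ∷ q) ≡ reverse q ++ v ∷ u ∷ reverse p
reverse-++-∷-∷ p q = trans (++-ʳ++ p) (ʳ++-defn q)

descent-split : ∀ i μ → suc (suc i) ≤ length μ → entry μ (suc (suc i)) < entry μ (suc i) →
  ∃[ p ] ∃[ u ] ∃[ v ] ∃[ q ]
    μ ≡ p ++ u ∷ v ∷ q × v < u × bump μ (suc (suc i)) ≡ p ++ u ∷ suc v ∷ q
descent-split zero    (u ∷ v ∷ q) _        v<u = [] , u , v , q , refl , v<u , refl
descent-split zero    (_ ∷ [])    (s≤s ()) _
descent-split (suc i) (a ∷ μ)     (s≤s le) v<u with descent-split i μ le v<u
... | p , u , v , q , μ≡ , v<u′ , bump≡ = a ∷ p , u , v , q , cong (a ∷_) μ≡ , v<u′ , cong (a ∷_) bump≡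

f-bump : ∀ p {u v} q → All (0 <_) (p ++ u ∷ v ∷ q) → Linked _≥_ (p ++ u ∷ v ∷ q) → v < u →
  f (p ++ u ∷ v ∷ q) + f (minusHat (p ++ u ∷ suc v ∷ q) 1) ≤ f (p ++ u ∷ suc v ∷ q)
  × 0 < f (minusHat (p ++ u ∷ suc v ∷ q) 1)
f-bump p {u} {v} q μ>0 μ↓ v<u =
  (begin
    f μ + f (minusHat μ⁺ 1)
      ≡⟨ cong₂ _+_ fμ≡ fμ⁺-1≡ ⟩
    F (xs ++ v ∷ u ∷ zs) + F (map (_∸ 1) (xs ++ suc v ∷ u ∷ zs))
      ≤⟨ F-bump xs v u zs (Linked-++⇒All≤ xs asc) ⟩
    F (xs ++ suc v ∷ u ∷ zs)
      ≡⟨ fμ⁺≡ ⟨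
    f μ⁺ ∎)
  , subst (0 <_) (sym fμ⁺-1≡) (F-bump-pos xs u zs v>0)
  where
  open ≤-Reasoning
  μ μ⁺ xs zs : List ℕ
  μ  = p ++ u ∷ v ∷ q
  μ⁺ = p ++ u ∷ suc v ∷ q
  xs = reverse q
  zs = reverse p
  asc : Linked _≤_ (xs ++ v ∷ u ∷ zs)
  asc = subst (Linked _≤_) (reverse-++-∷-∷ p q) (Linked-reverse μ↓)
  asc⁺ : Linked _≤_ (reverse μ⁺)
  asc⁺ = subst (Linked _≤_) (sym (reverse-++-∷-∷ p q)) (Linked-++-bump xs asc v<u)
  v>0 : 0 < v
  v>0 = All.head (All.tail (++⁻ʳ p μ>0))
  μ⁺>0 : All (0 <_) μ⁺
  μ⁺>0 = ++⁺ (++⁻ˡ p μ>0) (All.head (++⁻ʳ p μ>0) ∷ z<s ∷ All.tail (All.tail (++⁻ʳ p μ>0)))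
  fμ≡ : f μ ≡ F (xs ++ v ∷ u ∷ zs)
  fμ≡ = trans (f≡F∘reverse μ>0 (Linked-reverse μ↓)) (cong F (reverse-++-∷-∷ p q))
  fμ⁺≡ : f μ⁺ ≡ F (xs ++ suc v ∷ u ∷ zs)
  fμ⁺≡ = trans (f≡F∘reverse μ⁺>0 asc⁺) (cong F (reverse-++-∷-∷ p q))
  fμ⁺-1≡ : f (minusHat μ⁺ 1) ≡ F (map (_∸ 1) (xs ++ suc v ∷ u ∷ zs))
  fμ⁺-1≡ = trans (f-minusHat 1 μ⁺ asc⁺) (cong (F ∘ map (_∸ 1)) (reverse-++-∷-∷ p q))

m+n≤o⇒+n≤+o-+m : ∀ {m n o} → m + n ≤ o → + n ≤ℤ + o - + m
m+n≤o⇒+n≤+o-+m {m} {n} {o} m+n≤o rewrite [+m]-[+n]≡m⊖n o m | ≤-⊖ (m+n≤o⇒m≤o m m+n≤o) =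
  ℤ.+≤+ (m+n≤o⇒m≤o∸n n (subst (_≤ o) (+-comm m n) m+n≤o))

lemma3p3 : (n s i : ℕ) (μ : List ℕ) → 2 ≤ s → 2 ≤ i → i ≤ s →
    μ ⊢ n → length μ ≡ s → entry μ i < entry μ (pred i) →
    ((+ f (minusHat (bump μ i) 1)) ≤ℤ ((+ f (bump μ i)) - (+ f μ)))
      × ((+ 0) <ℤ (+ f (minusHat (bump μ i) 1)))
lemma3p3 n s (suc (suc i)) μ _ (s≤s (s≤s _)) i≤s ((μ>0 , μ↓) , _) refl descent
  with descent-split i μ i≤s descent
... | p , u , v , q , refl , v<u , bump≡ rewrite bump≡ =
  let ineq , positive = f-bump p q μ>0 μ↓ v<u in m+n≤o⇒+n≤+o-+m ineq , ℤ.+<+ positive
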